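{- Let $X=\mathrm{GF}(2)^{24}$ with coordinates $1,\dots,24$, let $w$ denote Hamming weight, let $M=\{x\in X: w(x)\text{ even}\}$, and let $C\subseteq M$ be the extended binary Golay code. Let $R\subseteq M$ be the set of vectors $x$ with $w(x)=0$, or $w(x)=2$, or ($w(x)=4$ and the $24$-th coordinate of $x$ equals $1$). Let $x,y\in R$ with $x\neq y$, and put $z=x+y$. Then $w(z)\in\{2,4,6\}$, and: if $w(z)=2$ then there is $c\in C$ with $w(z+c)=2$ (so the cosets $x+C$ and $y+C$ are adjacent in the graph whose vertices are the cosets of $C$ in $M$, two cosets being adjacent iff they have representatives differing by a vector of weight $2$); if $w(z)=4$ then there is no $c\in C$ with $w(z+c)=2$ (so these cosets are not adjacent); and if $w(z)=6$ and $c\in C$ has $w(c)=8$ with $w(z+c)=4$, then there is no $d\in C$ with $w(z+d)=2$.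
   Context: The extended binary Golay code is the $12$-dimensional binary linear code of length $24$ with minimum distance $8$, with weight distribution $1,759,2576,759,1$ in weights $0,8,12,16,24$. -}

module Defs where

open import Data.Bool using (Bool; true; false; _xor_)
open import Data.Nat using (ℕ; zero; suc; _≤_)
open import Data.Nat.Divisibility using (_∣_)
open import Data.Fin using (Fin; fromℕ)
open import Data.Vec using (Vec; []; _∷_; zipWith; replicate; lookup)
open import Data.List using (List; length)
open import Data.List.Membership.Propositional using (_∈_)
open import Data.List.Relation.Unary.Unique.Propositional using (Unique)
open import Data.Product using (_×_)
open import Data.Sum using (_⊎_)
open import Relation.Binary.PropositionalEquality using (_≡_; _≢_)

-- X = GF(2)^24, with GF(2) represented by Bool (true = 1).
X : Set
X = Vec Bool 24

_⊕_ : ∀ {n} → Vec Bool n → Vec Bool n → Vec Bool n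
_⊕_ = zipWith _xor_

zeroVec : X
zeroVec = replicate 24 false

wt : ∀ {n} → Vec Bool n → ℕ
wt [] = 0
wt (true ∷ xs) = suc (wt xs)
wt (false ∷ xs) = wt xs

InM : X → Set
InM x = 2 ∣ wt x

-- the 24-th coordinate (index 23 counting from 0)
coord24 : X → Bool
coord24 x = lookup x (fromℕ 23)

InR : X → Set
InR x = wt x ≡ 0 ⊎ (wt x ≡ 2 ⊎ (wt x ≡ 4 × coord24 x ≡ true))

-- An extended binary Golay code: a 12-dimensional binary linear code of
-- length 24 (i.e. a subset of GF(2)^24 closed under addition, nonempty,
-- with exactly 2^12 = 4096 elements) contained in M, with minimum distance 8.
-- The code is given by the duplicate-free list of its codewords.
record GolayCode : Set where
  field
    words      : List X
    distinct   : Unique words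
    size       : length words ≡ 4096
    hasZero    : zeroVec ∈ words
    closed     : ∀ {a b} → a ∈ words → b ∈ words → (a ⊕ b) ∈ words
    even       : ∀ {a} → a ∈ words → InM a
    minDist    : ∀ {a} → a ∈ words → a ≢ zeroVec → 8 ≤ wt a

{-# OPTIONS --safe #-}
-- Over GF(2), wt (a ⊕ b) + 2 · |a ∧ b| = wt a + wt b.  Hence z = x ⊕ y has even weight, and
-- that weight is at most 6 because two weight-4 vectors of R meet in the 24-th coordinate.
-- The other claims only use the minimum distance 8: by the triangle inequality no vector lies
-- at distance 4 from one codeword and at distance 2 from another, and when wt z = 4 the
-- codeword at distance 4 is 0.
module Submission where

open import Defs
open import Data.Bool using (Bool; true; false; _∧_; _xor_)
open import Data.Bool.Properties
  using (xor-assoc; xor-comm; xor-identityˡ; xor-identityʳ; xor-same)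
open import Data.Empty using (⊥-elim)
open import Data.Fin using (Fin; fromℕ)
import Data.Fin as Fin
open import Data.List.Membership.Propositional using (_∈_)
open import Data.Nat using (ℕ; suc; _+_; _*_; _≤_; _<_; z≤n; s≤s)
open import Data.Nat.Divisibility using (_∣_; divides; ∣m∣n⇒∣m+n; ∣m+n∣m⇒∣n; m∣m*n)
open import Data.Nat.Properties
  using (+-suc; +-comm; n≤1+n; ≤-trans; ≤-reflexive; m≤m+n; +-mono-≤; +-monoʳ-≤;
         *-monoʳ-≤; +-cancelʳ-≤; <⇒≱; module ≤-Reasoning)
open import Data.Nat.Tactic.RingSolver using (solve-∀)
open import Data.Product using (_×_; _,_; ∃-syntax)
open import Data.Sum using (_⊎_; inj₁; inj₂)
open import Data.Vec using (Vec; []; _∷_; zipWith; replicate; lookup)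
open import Data.Vec.Properties
  using (zipWith-assoc; zipWith-comm; zipWith-identityˡ; zipWith-identityʳ)
open import Function using (_∘_)
open import Relation.Nullary using (¬_)
open import Relation.Binary.PropositionalEquality
  using (_≡_; _≢_; refl; sym; trans; cong; cong₂; subst; module ≡-Reasoning)

⊕-assoc : ∀ {n} (a b c : Vec Bool n) → (a ⊕ b) ⊕ c ≡ a ⊕ (b ⊕ c)
⊕-assoc = zipWith-assoc xor-assoc

⊕-comm : ∀ {n} (a b : Vec Bool n) → a ⊕ b ≡ b ⊕ a
⊕-comm = zipWith-comm xor-comm

⊕-identityˡ : ∀ {n} (a : Vec Bool n) → replicate n false ⊕ a ≡ a
⊕-identityˡ = zipWith-identityˡ xor-identityˡ

⊕-identityʳ : ∀ {n} (a : Vec Bool n) → a ⊕ replicate n false ≡ a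
⊕-identityʳ = zipWith-identityʳ xor-identityʳ

⊕-self : ∀ {n} (a : Vec Bool n) → a ⊕ a ≡ replicate n false
⊕-self []      = refl
⊕-self (x ∷ a) = cong₂ _∷_ (xor-same x) (⊕-self a)

⊕-cancel-middle : ∀ {n} (a b c : Vec Bool n) → (a ⊕ b) ⊕ (b ⊕ c) ≡ a ⊕ c
⊕-cancel-middle a b c = begin
  (a ⊕ b) ⊕ (b ⊕ c)           ≡⟨ ⊕-assoc a b (b ⊕ c) ⟩
  a ⊕ (b ⊕ (b ⊕ c))           ≡⟨ cong (a ⊕_) (sym (⊕-assoc b b c)) ⟩
  a ⊕ ((b ⊕ b) ⊕ c)           ≡⟨ cong (λ v → a ⊕ (v ⊕ c)) (⊕-self b) ⟩
  a ⊕ (replicate _ false ⊕ c) ≡⟨ cong (a ⊕_) (⊕-identityˡ c) ⟩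
  a ⊕ c                       ∎
  where open ≡-Reasoning

⊕≡0⇒≡ : ∀ {n} (a b : Vec Bool n) → a ⊕ b ≡ replicate n false → a ≡ b
⊕≡0⇒≡ a b a⊕b≡0 = begin
  a                      ≡⟨ sym (⊕-identityʳ a) ⟩
  a ⊕ replicate _ false  ≡⟨ cong (a ⊕_) (sym (⊕-self b)) ⟩
  a ⊕ (b ⊕ b)            ≡⟨ sym (⊕-assoc a b b) ⟩
  (a ⊕ b) ⊕ b            ≡⟨ cong (_⊕ b) a⊕b≡0 ⟩
  replicate _ false ⊕ b  ≡⟨ ⊕-identityˡ b ⟩
  b                      ∎
  where open ≡-Reasoning

wt≡0⇒≡0 : ∀ {n} (v : Vec Bool n) → wt v ≡ 0 → v ≡ replicate n false
wt≡0⇒≡0 []          _    = refl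
wt≡0⇒≡0 (false ∷ v) wt≡0 = cong (false ∷_) (wt≡0⇒≡0 v wt≡0)

wt-⊕≡0⇒≡ : ∀ {n} (a b : Vec Bool n) → wt (a ⊕ b) ≡ 0 → a ≡ b
wt-⊕≡0⇒≡ a b = ⊕≡0⇒≡ a b ∘ wt≡0⇒≡0 (a ⊕ b)

common : ∀ {n} → Vec Bool n → Vec Bool n → ℕ
common a b = wt (zipWith _∧_ a b)

common-pos : ∀ {n} (i : Fin n) (a b : Vec Bool n) →
             lookup a i ≡ true → lookup b i ≡ true → 0 < common a b
common-pos Fin.zero    (true ∷ _) (true ∷ _) refl refl = s≤s z≤n
common-pos (Fin.suc i) (x ∷ a)    (y ∷ b)    aᵢ  bᵢ  with x ∧ y
... | true  = s≤s z≤n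
... | false = common-pos i a b aᵢ bᵢ

wt-⊕ : ∀ {n} (a b : Vec Bool n) → wt (a ⊕ b) + 2 * common a b ≡ wt a + wt b
wt-⊕ []          []          = refl
wt-⊕ (true ∷ a)  (true ∷ b)  = begin
  wt (a ⊕ b) + 2 * suc (common a b) ≡⟨ shift (wt (a ⊕ b)) (common a b) ⟩
  2 + (wt (a ⊕ b) + 2 * common a b) ≡⟨ cong (2 +_) (wt-⊕ a b) ⟩
  2 + (wt a + wt b)                 ≡⟨ cong suc (sym (+-suc (wt a) (wt b))) ⟩
  suc (wt a + suc (wt b))           ∎
  where
  open ≡-Reasoning
  shift : ∀ m o → m + 2 * suc o ≡ 2 + (m + 2 * o)
  shift = solve-∀
wt-⊕ (true ∷ a)  (false ∷ b) = cong suc (wt-⊕ a b)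
wt-⊕ (false ∷ a) (true ∷ b)  = trans (cong suc (wt-⊕ a b)) (sym (+-suc (wt a) (wt b)))
wt-⊕ (false ∷ a) (false ∷ b) = wt-⊕ a b

wt-⊕-≤ : ∀ {n} (a b : Vec Bool n) → wt (a ⊕ b) ≤ wt a + wt b
wt-⊕-≤ a b = subst (wt (a ⊕ b) ≤_) (wt-⊕ a b) (m≤m+n (wt (a ⊕ b)) _)

wt-⊕-triangle : ∀ {n} (a b c : Vec Bool n) → wt (a ⊕ c) ≤ wt (a ⊕ b) + wt (b ⊕ c)
wt-⊕-triangle a b c =
  subst (λ v → wt v ≤ wt (a ⊕ b) + wt (b ⊕ c)) (⊕-cancel-middle a b c) (wt-⊕-≤ (a ⊕ b) (b ⊕ c))

wt-⊕-even : ∀ {n} (a b : Vec Bool n) → 2 ∣ wt a → 2 ∣ wt b → 2 ∣ wt (a ⊕ b)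
wt-⊕-even a b 2∣a 2∣b = ∣m+n∣m⇒∣n 2∣2o+wt (m∣m*n (common a b))
  where
  2∣2o+wt : 2 ∣ 2 * common a b + wt (a ⊕ b)
  2∣2o+wt = subst (2 ∣_) (trans (sym (wt-⊕ a b)) (+-comm (wt (a ⊕ b)) _)) (∣m∣n⇒∣m+n 2∣a 2∣b)

even-nonzero-≤6 : ∀ {n} → 2 ∣ n → n ≢ 0 → n ≤ 6 → n ≡ 2 ⊎ (n ≡ 4 ⊎ n ≡ 6)
even-nonzero-≤6 (divides 0 refl) n≢0 _ = ⊥-elim (n≢0 refl)
even-nonzero-≤6 (divides 1 refl) _   _ = inj₁ refl
even-nonzero-≤6 (divides 2 refl) _   _ = inj₂ (inj₁ refl)
even-nonzero-≤6 (divides 3 refl) _   _ = inj₂ (inj₂ refl)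
even-nonzero-≤6 (divides (suc (suc (suc (suc _)))) refl) _
  (s≤s (s≤s (s≤s (s≤s (s≤s (s≤s ()))))))

R-light-or-heavy : ∀ x → InR x → wt x ≤ 2 ⊎ (wt x ≡ 4 × coord24 x ≡ true)
R-light-or-heavy _ (inj₁ x≡0)        = inj₁ (≤-trans (≤-reflexive x≡0) z≤n)
R-light-or-heavy _ (inj₂ (inj₁ x≡2)) = inj₁ (≤-reflexive x≡2)
R-light-or-heavy _ (inj₂ (inj₂ x≡4)) = inj₂ x≡4

R⇒wt≤4 : ∀ x → InR x → wt x ≤ 4
R⇒wt≤4 x rx with R-light-or-heavy x rx
... | inj₁ x≤2       = ≤-trans x≤2 (m≤m+n 2 2)
... | inj₂ (x≡4 , _) = ≤-reflexive x≡4

R⊆M : ∀ x → InR x → InM x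
R⊆M _ (inj₁ x≡0)              = subst (2 ∣_) (sym x≡0) (divides 0 refl)
R⊆M _ (inj₂ (inj₁ x≡2))       = subst (2 ∣_) (sym x≡2) (divides 1 refl)
R⊆M _ (inj₂ (inj₂ (x≡4 , _))) = subst (2 ∣_) (sym x≡4) (divides 2 refl)

R-pair-weight : ∀ x y → InR x → InR y → wt x + wt y ≤ 6 + 2 * common x y
R-pair-weight x y rx ry with R-light-or-heavy x rx | R-light-or-heavy y ry
... | inj₁ x≤2 | _ =
  ≤-trans (+-mono-≤ x≤2 (R⇒wt≤4 y ry)) (m≤m+n 6 _)
... | inj₂ (x≡4 , _) | inj₁ y≤2 =
  ≤-trans (+-mono-≤ (≤-reflexive x≡4) y≤2) (m≤m+n 6 _)
... | inj₂ (x≡4 , x₂₄) | inj₂ (y≡4 , y₂₄) = begin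
  wt x + wt y        ≡⟨ cong₂ _+_ x≡4 y≡4 ⟩
  6 + 2 * 1          ≤⟨ +-monoʳ-≤ 6 (*-monoʳ-≤ 2 (common-pos (fromℕ 23) x y x₂₄ y₂₄)) ⟩
  6 + 2 * common x y ∎
  where open ≤-Reasoning

R-difference-≤6 : ∀ x y → InR x → InR y → wt (x ⊕ y) ≤ 6
R-difference-≤6 x y rx ry = +-cancelʳ-≤ (2 * common x y) (wt (x ⊕ y)) 6
  (subst (_≤ 6 + 2 * common x y) (sym (wt-⊕ x y)) (R-pair-weight x y rx ry))

R-difference-weight : ∀ x y → InR x → InR y → x ≢ y →
                      wt (x ⊕ y) ≡ 2 ⊎ (wt (x ⊕ y) ≡ 4 ⊎ wt (x ⊕ y) ≡ 6)
R-difference-weight x y rx ry x≢y = even-nonzero-≤6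
  (wt-⊕-even x y (R⊆M x rx) (R⊆M y ry)) (x≢y ∘ wt-⊕≡0⇒≡ x y) (R-difference-≤6 x y rx ry)

module _ (G : GolayCode) where
  open GolayCode G

  codewords-far-apart : ∀ {c d} → c ∈ words → d ∈ words → c ≢ d → 8 ≤ wt (c ⊕ d)
  codewords-far-apart {c} {d} c∈C d∈C c≢d = minDist (closed c∈C d∈C) (c≢d ∘ ⊕≡0⇒≡ c d)

  distances-to-distinct-codewords : ∀ {c d} (z : X) → c ∈ words → d ∈ words → c ≢ d →
                                    8 ≤ wt (z ⊕ c) + wt (z ⊕ d)
  distances-to-distinct-codewords {c} {d} z c∈C d∈C c≢d = begin
    8                       ≤⟨ codewords-far-apart c∈C d∈C c≢d ⟩
    wt (c ⊕ d)              ≤⟨ wt-⊕-triangle c z d ⟩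
    wt (c ⊕ z) + wt (z ⊕ d) ≡⟨ cong (λ v → wt v + wt (z ⊕ d)) (⊕-comm c z) ⟩
    wt (z ⊕ c) + wt (z ⊕ d) ∎
    where open ≤-Reasoning

  no-codeword-at-distance-2 : ∀ {c} (z : X) → c ∈ words → wt (z ⊕ c) ≡ 4 →
                              ¬ (∃[ d ] (d ∈ words × wt (z ⊕ d) ≡ 2))
  no-codeword-at-distance-2 {c} z c∈C z⊕c≡4 (d , d∈C , z⊕d≡2) =
    <⇒≱ distances<8 (distances-to-distinct-codewords z c∈C d∈C c≢d)
    where
    c≢d : c ≢ d
    c≢d refl with trans (sym z⊕c≡4) z⊕d≡2
    ... | ()
    distances<8 : wt (z ⊕ c) + wt (z ⊕ d) < 8
    distances<8 = subst (_< 8) (sym (cong₂ _+_ z⊕c≡4 z⊕d≡2)) (s≤s (n≤1+n 6))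

mainTheorem3 : (G : GolayCode) → (x y : X) → InR x → InR y → x ≢ y →
    (wt (x ⊕ y) ≡ 2 ⊎ (wt (x ⊕ y) ≡ 4 ⊎ wt (x ⊕ y) ≡ 6))
    × ((wt (x ⊕ y) ≡ 2 → ∃[ c ] (c ∈ GolayCode.words G × wt ((x ⊕ y) ⊕ c) ≡ 2))
    × ((wt (x ⊕ y) ≡ 4 → ¬ (∃[ c ] (c ∈ GolayCode.words G × wt ((x ⊕ y) ⊕ c) ≡ 2)))
    × (wt (x ⊕ y) ≡ 6 → (c : X) → c ∈ GolayCode.words G → wt c ≡ 8 → wt ((x ⊕ y) ⊕ c) ≡ 4
        → ¬ (∃[ d ] (d ∈ GolayCode.words G × wt ((x ⊕ y) ⊕ d) ≡ 2)))))
mainTheorem3 G x y rx ry x≢y =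
    R-difference-weight x y rx ry x≢y
  , (λ z≡2 → zeroVec , hasZero , distance-to-zero z≡2)
  , (λ z≡4 → no-codeword-at-distance-2 G z hasZero (distance-to-zero z≡4))
  , (λ _ c c∈C _ z⊕c≡4 → no-codeword-at-distance-2 G z c∈C z⊕c≡4)
  where
  open GolayCode G
  z : X
  z = x ⊕ y
  distance-to-zero : ∀ {k} → wt z ≡ k → wt (z ⊕ zeroVec) ≡ k
  distance-to-zero = trans (cong wt (⊕-identityʳ z))
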